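{- Let $G$ be a finite abelian group and let $A_1,\dots,A_m$ be pairwise disjoint nonempty subsets that partition $G$. Then the collection is bimodal if and only if each $A_i$ with $|A_i|>1$ is a coset of $H_i$.
   Context: $G$ is written additively, $G^*=G\setminus\{0\}$, $k_j=|A_j|$. For $\delta\in G^*$, $N_j(\delta)=|\{(a,b): a\in A_j,\ b\in A_i \text{ for some } i\neq j,\ a-b=\delta\}|$. The collection is bimodal if $N_j(\delta)\in\{0,k_j\}$ for all $\delta\in G^*$ and all $j$. $H_i$ is the subgroup of $G$ generated by $\{g_1-g_2: g_1,g_2\in A_i,\ g_1\neq g_2\}$. -}

module Defs where

open import Data.Nat using (ℕ)
open import Data.Fin using (Fin; _≟_)
open import Data.List using (List; length; filter; allFin; cartesianProduct)
open import Data.Product using (_×_; _,_; ∃; ∃-syntax)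
open import Data.Sum using (_⊎_)
open import Relation.Binary.PropositionalEquality using (_≡_; _≢_)
open import Relation.Nullary.Decidable using (_×-dec_; ¬?)
open import Algebra.Structures using (IsAbelianGroup)

-- A finite abelian group of order n, presented (up to isomorphism) with
-- carrier Fin n and propositional equality.
record FinAbGroup (n : ℕ) : Set where
  infixl 6 _+_
  field
    _+_ : Fin n → Fin n → Fin n
    0#  : Fin n
    -_  : Fin n → Fin n
    isAbelianGroup : IsAbelianGroup _≡_ _+_ 0# -_

  _-_ : Fin n → Fin n → Fin n
  x - y = x + (- y)

module _ {n : ℕ} (G : FinAbGroup n) where
  open FinAbGroup G

  -- A partition of G into m blocks A_1, ..., A_m is given by a labelling
  -- c : G → Fin m, with A_i = { x | c x ≡ i }.  The blocks are then
  -- automatically pairwise disjoint and cover G; nonemptiness of every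
  -- block is surjectivity of c.
  AllNonempty : {m : ℕ} → (Fin n → Fin m) → Set
  AllNonempty {m} c = (i : Fin m) → ∃[ x ] c x ≡ i

  blockSize : {m : ℕ} → (Fin n → Fin m) → Fin m → ℕ
  blockSize c i = length (filter (λ x → c x ≟ i) (allFin n))

  N : {m : ℕ} → (Fin n → Fin m) → Fin m → Fin n → ℕ
  N c j δ = length (filter
    (λ p → (c (Data.Product.proj₁ p) ≟ j)
           ×-dec (¬? (c (Data.Product.proj₂ p) ≟ j)
           ×-dec ((Data.Product.proj₁ p - Data.Product.proj₂ p) ≟ δ)))
    (cartesianProduct (allFin n) (allFin n)))

  Bimodal : {m : ℕ} → (Fin n → Fin m) → Set
  Bimodal {m} c = (δ : Fin n) → δ ≢ 0# → (j : Fin m) →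
    (N c j δ ≡ 0) ⊎ (N c j δ ≡ blockSize c j)

  data Span (S : Fin n → Set) : Fin n → Set where
    gen  : ∀ {x} → S x → Span S x
    zero : Span S 0#
    neg  : ∀ {x} → Span S x → Span S (- x)
    add  : ∀ {x y} → Span S x → Span S y → Span S (x + y)

  Differences : {m : ℕ} → (Fin n → Fin m) → Fin m → Fin n → Set
  Differences c i y =
    ∃[ g₁ ] ∃[ g₂ ] (c g₁ ≡ i × c g₂ ≡ i × g₁ ≢ g₂ × y ≡ g₁ - g₂)

  H : {m : ℕ} → (Fin n → Fin m) → Fin m → Fin n → Set
  H c i = Span (Differences c i)

  IsCosetOfH : {m : ℕ} → (Fin n → Fin m) → Fin m → Set
  IsCosetOfH c i = ∃[ g ] ((x : Fin n) →
    (c x ≡ i → ∃[ h ] (H c i h × x ≡ g + h)) ×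
    (∃[ h ] (H c i h × x ≡ g + h) → c x ≡ i))

module Submission where

-- Write A_j = c⁻¹(j) for the blocks of the partition and say that
-- translation by h PRESERVES A_j when A_j + h ⊆ A_j, and DISPLACES A_j
-- when (A_j + h) ∩ A_j = ∅.
--
-- 1. Counting.  In a pair (a , b) counted by N_j(δ) the entry b = a - δ
--    is forced by a, so N_j(δ) counts the a ∈ A_j with a - δ ∉ A_j.
--    With the remaining a ∈ A_j these add up to k_j, hence
--    N_j(δ) ∈ {0 , k_j} iff translation by -δ preserves or displaces A_j.
-- 2. Call A_j RIGID when every translation mapping some point of A_j into
--    A_j preserves A_j.  By 1, A_j is bimodal iff it is rigid.
-- 3. A rigid A_j is preserved by all of H_j (induction on the generation
--    of H_j), so A_j = g + H_j for any g ∈ A_j.  Conversely a coset of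
--    H_j is rigid, since the witnessing translation lies in H_j.
-- 4. A block with k_j ≤ 1 is bimodal by counting alone, which is why the
--    converse only asks cosets of the blocks with k_j > 1.

open import Defs
open import Level using (Level; 0ℓ)
open import Data.Nat using (ℕ; zero; suc; _<_; _≤_; s≤s) renaming (_+_ to _+ℕ_)
open import Data.Nat.Properties using (+-cancelˡ-≡; +-identityʳ; +-suc; <-irrefl; ≮⇒≥; _<?_)
open import Data.Fin using (Fin; _≟_)
open import Data.Fin.Properties using (any?)
open import Data.Product using (_×_; _,_; proj₁; proj₂; ∃-syntax)
open import Data.Sum using (_⊎_; inj₁; inj₂)
open import Data.Empty using (⊥-elim)
open import Data.List using (List; []; _∷_; length; filter; allFin; cartesianProduct; map; _++_)
open import Data.List.Properties using (filter-++; length-++; filter-none; filter-some)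
open import Data.List.Membership.Propositional using (_∈_; lose)
open import Data.List.Membership.Propositional.Properties using (∈-allFin)
open import Data.List.Relation.Unary.Any using (here; there)
open import Data.List.Relation.Unary.All as All using ()
open import Data.List.Relation.Unary.AllPairs using (_∷_)
open import Data.List.Relation.Unary.Unique.Propositional using (Unique)
open import Data.List.Relation.Unary.Unique.Propositional.Properties using (allFin⁺)
open import Relation.Nullary using (¬_; yes; no)
open import Relation.Nullary.Decidable using (_×-dec_; ¬?; decidable-stable)
open import Relation.Unary using (Pred; Decidable)
open import Relation.Binary.PropositionalEquality using (_≡_; _≢_; refl; sym; trans; cong; cong₂; subst; module ≡-Reasoning)
open import Algebra.Bundles using (AbelianGroup)

private
  variable
    a b p q r : Level
    A : Set a
    B : Set b

count : {P : Pred A p} → Decidable P → List A → ℕ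
count P? xs = length (filter P? xs)

count-none : {P : Pred A p} (P? : Decidable P) (xs : List A) →
  (∀ x → x ∈ xs → ¬ P x) → count P? xs ≡ 0
count-none P? xs none = cong length (filter-none P? (All.tabulate (λ {x} x∈ → none x x∈)))

count≡0⇒none : {P : Pred A p} (P? : Decidable P) (xs : List A) →
  count P? xs ≡ 0 → ∀ x → x ∈ xs → ¬ P x
count≡0⇒none P? xs count≡0 x x∈ px =
  <-irrefl refl (subst (0 <_) count≡0 (filter-some P? (lose x∈ px)))

count-unique : {P : Pred A p} (P? : Decidable P) (t : A) (xs : List A) → Unique xs →
  t ∈ xs → P t → (∀ y → P y → y ≡ t) → count P? xs ≡ 1
count-unique P? t (y ∷ ys) (y∉ys ∷ _) t∈ pt only with P? y
... | yes py = cong suc (count-none P? ys (λ z z∈ pz →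
                 All.lookup y∉ys z∈ (trans (only y py) (sym (only z pz)))))
count-unique P? t (y ∷ ys) _             (here refl) pt only | no ¬py = ⊥-elim (¬py pt)
count-unique P? t (y ∷ ys) (_ ∷ unique) (there t∈)  pt only | no ¬py =
  count-unique P? t ys unique t∈ pt only

count-split : {P : Pred A p} {Q : Pred A q} (P? : Decidable P) (Q? : Decidable Q) (xs : List A) →
  count (λ x → P? x ×-dec ¬? (Q? x)) xs +ℕ count (λ x → P? x ×-dec Q? x) xs ≡ count P? xs
count-split P? Q? [] = refl
count-split P? Q? (x ∷ xs) with P? x | Q? x
... | yes _ | yes _ = trans (+-suc _ _) (cong suc (count-split P? Q? xs))
... | yes _ | no _  = cong suc (count-split P? Q? xs)
... | no _  | yes _ = count-split P? Q? xs
... | no _  | no _  = count-split P? Q? xs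

count-++ : {P : Pred A p} (P? : Decidable P) (xs ys : List A) →
  count P? (xs ++ ys) ≡ count P? xs +ℕ count P? ys
count-++ P? xs ys = trans (cong length (filter-++ P? xs ys)) (length-++ (filter P? xs))

count-map : {P : Pred B p} (P? : Decidable P) (f : A → B) (xs : List A) →
  count P? (map f xs) ≡ count (λ x → P? (f x)) xs
count-map P? f [] = refl
count-map P? f (x ∷ xs) with P? (f x)
... | yes _ = cong suc (count-map P? f xs)
... | no _  = count-map P? f xs

count-cons : {P : Pred A p} (P? : Decidable P) (x : A) (xs : List A) (k : ℕ) →
  (P x → k ≡ 1) → (¬ P x → k ≡ 0) → k +ℕ count P? xs ≡ count P? (x ∷ xs)
count-cons P? x xs k one none with P? x
... | yes px = cong (_+ℕ count P? xs) (one px)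
... | no ¬px = cong (_+ℕ count P? xs) (none ¬px)

count-cartesianProduct : {R : Pred (A × B) r} (R? : Decidable R) {S : Pred A p} (S? : Decidable S)
  (xs : List A) (ys : List B) →
  (∀ x → S x → count (λ y → R? (x , y)) ys ≡ 1) →
  (∀ x → ¬ S x → count (λ y → R? (x , y)) ys ≡ 0) →
  count R? (cartesianProduct xs ys) ≡ count S? xs
count-cartesianProduct R? S? [] ys one none = refl
count-cartesianProduct R? S? (x ∷ xs) ys one none = begin
  count R? (map (x ,_) ys ++ cartesianProduct xs ys)
    ≡⟨ count-++ R? (map (x ,_) ys) (cartesianProduct xs ys) ⟩
  count R? (map (x ,_) ys) +ℕ count R? (cartesianProduct xs ys)
    ≡⟨ cong₂ _+ℕ_ (count-map R? (x ,_) ys) (count-cartesianProduct R? S? xs ys one none) ⟩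
  count (λ y → R? (x , y)) ys +ℕ count S? xs
    ≡⟨ count-cons S? x xs _ (one x) (none x) ⟩
  count S? (x ∷ xs) ∎
  where open ≡-Reasoning

summand-dichotomy : ∀ {x y k} → x +ℕ y ≡ k → x ≡ 0 ⊎ x ≡ k → x ≡ 0 ⊎ y ≡ 0
summand-dichotomy x+y≡k (inj₁ x≡0) = inj₁ x≡0
summand-dichotomy {x} x+y≡k (inj₂ x≡k) =
  inj₂ (+-cancelˡ-≡ x _ 0 (trans x+y≡k (trans (sym x≡k) (sym (+-identityʳ x)))))

summand-dichotomy⁻ : ∀ {x y k} → x +ℕ y ≡ k → x ≡ 0 ⊎ y ≡ 0 → x ≡ 0 ⊎ x ≡ k
summand-dichotomy⁻ x+y≡k (inj₁ x≡0) = inj₁ x≡0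
summand-dichotomy⁻ {x} x+y≡k (inj₂ refl) = inj₂ (trans (sym (+-identityʳ x)) x+y≡k)

summands-of-≤1 : ∀ x y → x +ℕ y ≤ 1 → x ≡ 0 ⊎ y ≡ 0
summands-of-≤1 zero          y _ = inj₁ refl
summands-of-≤1 (suc zero)    zero _ = inj₂ refl
summands-of-≤1 (suc zero)    (suc y) (s≤s ())
summands-of-≤1 (suc (suc x)) y (s≤s ())

module GroupFacts {n : ℕ} (G : FinAbGroup n) where
  open FinAbGroup G public

  abelianGroup : AbelianGroup 0ℓ 0ℓ
  abelianGroup = record { isAbelianGroup = isAbelianGroup }

  open AbelianGroup abelianGroup public using (assoc; comm; identityʳ; inverseʳ)
  open import Algebra.Properties.AbelianGroup abelianGroup public
    using (⁻¹-involutive; ⁻¹-injective; ε⁻¹≈ε; ⁻¹-anti-homo‿-; //-rightDividesˡ; //-rightDividesʳ)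
  open ≡-Reasoning

  add-sub : ∀ x y → y + (x - y) ≡ x
  add-sub x y = trans (comm y (x - y)) (//-rightDividesˡ y x)

  add-sub-cancel : ∀ x h → (x + h) - h ≡ x
  add-sub-cancel x h = //-rightDividesʳ h x

  add-sub-left : ∀ x h → (x + h) - x ≡ h
  add-sub-left x h = trans (cong (_- x) (comm x h)) (//-rightDividesʳ x h)

  sub-sub : ∀ x y → x - (x - y) ≡ y
  sub-sub x y = begin
    x - (x - y)   ≡⟨ cong (x +_) (⁻¹-anti-homo‿- x y) ⟩
    x + (y - x)   ≡⟨ add-sub y x ⟩
    y             ∎

  sub-solve : ∀ {x y δ} → x - y ≡ δ → y ≡ x - δ
  sub-solve {x} {y} x-y≡δ = trans (sym (sub-sub x y)) (cong (λ z → x - z) x-y≡δ)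

  neg-nonzero : ∀ {h} → h ≢ 0# → - h ≢ 0#
  neg-nonzero h≢0 -h≡0 = h≢0 (⁻¹-injective (trans -h≡0 (sym ε⁻¹≈ε)))

module Block {n : ℕ} (G : FinAbGroup n) {m : ℕ} (c : Fin n → Fin m) (j : Fin m) where
  open GroupFacts G

  Preserves : Fin n → Set
  Preserves h = ∀ a → c a ≡ j → c (a + h) ≡ j

  Displaces : Fin n → Set
  Displaces h = ∀ a → c a ≡ j → c (a + h) ≢ j

  exits? : (h : Fin n) → Decidable (λ a → c a ≡ j × ¬ c (a + h) ≡ j)
  exits? h a = (c a ≟ j) ×-dec ¬? (c (a + h) ≟ j)

  stays? : (h : Fin n) → Decidable (λ a → c a ≡ j × c (a + h) ≡ j)
  stays? h a = (c a ≟ j) ×-dec (c (a + h) ≟ j)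

  exits : Fin n → ℕ
  exits h = count (exits? h) (allFin n)

  stays : Fin n → ℕ
  stays h = count (stays? h) (allFin n)

  exits+stays : ∀ h → exits h +ℕ stays h ≡ blockSize G c j
  exits+stays h = count-split (λ a → c a ≟ j) (λ a → c (a + h) ≟ j) (allFin n)

  -- N_j(δ) counts the exits under translation by -δ, as b = a - δ is forced.
  N≡exits : ∀ δ → N G c j δ ≡ exits (- δ)
  N≡exits δ = count-cartesianProduct _ (exits? (- δ)) (allFin n) (allFin n) single none
    where
    single : ∀ x → c x ≡ j × ¬ c (x - δ) ≡ j →
      count (λ y → (c x ≟ j) ×-dec (¬? (c y ≟ j) ×-dec ((x - y) ≟ δ))) (allFin n) ≡ 1
    single x (cx , ¬cx-δ) = count-unique _ (x - δ) (allFin n) (allFin⁺ n) (∈-allFin _)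
      (cx , ¬cx-δ , sub-sub x δ) (λ y (_ , _ , x-y≡δ) → sub-solve x-y≡δ)

    none : ∀ x → ¬ (c x ≡ j × ¬ c (x - δ) ≡ j) →
      count (λ y → (c x ≟ j) ×-dec (¬? (c y ≟ j) ×-dec ((x - y) ≟ δ))) (allFin n) ≡ 0
    none x ¬exit = count-none _ (allFin n) λ y _ (cx , ¬cy , x-y≡δ) →
      ¬exit (cx , λ cx-δ → ¬cy (subst (λ z → c z ≡ j) (sym (sub-solve x-y≡δ)) cx-δ))

  preserves⇒noExits : ∀ {h} → Preserves h → exits h ≡ 0
  preserves⇒noExits pres = count-none _ (allFin n) λ a _ (ca , ¬ca+h) → ¬ca+h (pres a ca)

  noExits⇒preserves : ∀ {h} → exits h ≡ 0 → Preserves h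
  noExits⇒preserves {h} exits≡0 a ca = decidable-stable (c (a + h) ≟ j) λ ¬ca+h →
    count≡0⇒none _ (allFin n) exits≡0 a (∈-allFin a) (ca , ¬ca+h)

  displaces⇒noStays : ∀ {h} → Displaces h → stays h ≡ 0
  displaces⇒noStays disp = count-none _ (allFin n) λ a _ (ca , ca+h) → disp a ca ca+h

  noStays⇒displaces : ∀ {h} → stays h ≡ 0 → Displaces h
  noStays⇒displaces stays≡0 a ca ca+h = count≡0⇒none _ (allFin n) stays≡0 a (∈-allFin a) (ca , ca+h)

  BimodalAt : Fin n → Set
  BimodalAt δ = N G c j δ ≡ 0 ⊎ N G c j δ ≡ blockSize G c j

  bimodalAt⇒dichotomy : ∀ δ → BimodalAt δ → Preserves (- δ) ⊎ Displaces (- δ)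
  bimodalAt⇒dichotomy δ bimodal with summand-dichotomy (exits+stays (- δ))
      (subst (λ k → k ≡ 0 ⊎ k ≡ blockSize G c j) (N≡exits δ) bimodal)
  ... | inj₁ exits≡0 = inj₁ (noExits⇒preserves exits≡0)
  ... | inj₂ stays≡0 = inj₂ (noStays⇒displaces stays≡0)

  bimodalAt-from-counts : ∀ δ → exits (- δ) ≡ 0 ⊎ stays (- δ) ≡ 0 → BimodalAt δ
  bimodalAt-from-counts δ noExits-or-noStays =
    subst (λ k → k ≡ 0 ⊎ k ≡ blockSize G c j) (sym (N≡exits δ))
      (summand-dichotomy⁻ (exits+stays (- δ)) noExits-or-noStays)

  dichotomy⇒bimodalAt : ∀ δ → Preserves (- δ) ⊎ Displaces (- δ) → BimodalAt δ
  dichotomy⇒bimodalAt δ (inj₁ pres) = bimodalAt-from-counts δ (inj₁ (preserves⇒noExits pres))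
  dichotomy⇒bimodalAt δ (inj₂ disp) = bimodalAt-from-counts δ (inj₂ (displaces⇒noStays disp))

  small⇒bimodalAt : blockSize G c j ≤ 1 → ∀ δ → BimodalAt δ
  small⇒bimodalAt k≤1 δ = bimodalAt-from-counts δ
    (summands-of-≤1 _ _ (subst (_≤ 1) (sym (exits+stays (- δ))) k≤1))

  Rigid : Set
  Rigid = ∀ a h → c a ≡ j → c (a + h) ≡ j → Preserves h

  -- A bimodal block is rigid: the translation by h ≠ 0 keeps a ∈ A_j
  -- inside, so bimodality at -h forces it to preserve A_j.
  bimodal⇒rigid : (∀ δ → δ ≢ 0# → BimodalAt δ) → Rigid
  bimodal⇒rigid bimodal a h ca ca+h with h ≟ 0#
  ... | yes refl = λ b cb → subst (λ z → c z ≡ j) (sym (identityʳ b)) cb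
  ... | no h≢0 with subst (λ k → Preserves k ⊎ Displaces k) (⁻¹-involutive h)
                    (bimodalAt⇒dichotomy (- h) (bimodal (- h) (neg-nonzero h≢0)))
  ...   | inj₁ pres = pres
  ...   | inj₂ disp = ⊥-elim (disp a ca ca+h)

  -- A rigid block is bimodal at every δ: either some a ∈ A_j stays in
  -- A_j under -δ, and rigidity makes -δ preserve A_j, or none does.
  rigid⇒bimodalAt : Rigid → ∀ δ → BimodalAt δ
  rigid⇒bimodalAt rigid δ with any? (stays? (- δ))
  ... | yes (a , ca , ca-δ) = dichotomy⇒bimodalAt δ (inj₁ (rigid a (- δ) ca ca-δ))
  ... | no noStay = dichotomy⇒bimodalAt δ (inj₂ λ a ca ca-δ → noStay (a , ca , ca-δ))

  -- Differences of elements of A_j lie in H_j (including the difference 0).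
  difference∈H : ∀ {x y} → c x ≡ j → c y ≡ j → H G c j (x - y)
  difference∈H {x} {y} cx cy with x ≟ y
  ... | yes refl = subst (H G c j) (sym (inverseʳ x)) zero
  ... | no x≢y = gen (x , y , cx , cy , x≢y , refl)

  -- A rigid block is preserved by every element of H_j; the element g of
  -- A_j provides the point witnessing rigidity for inverses.
  rigid⇒preservesH : Rigid → ∀ {g} → c g ≡ j → ∀ {h} → H G c j h → Preserves h
  rigid⇒preservesH rigid cg (gen (g₁ , g₂ , cg₁ , cg₂ , _ , refl)) =
    rigid g₂ (g₁ - g₂) cg₂ (subst (λ z → c z ≡ j) (sym (add-sub g₁ g₂)) cg₁)
  rigid⇒preservesH rigid cg zero a ca = subst (λ z → c z ≡ j) (sym (identityʳ a)) ca
  rigid⇒preservesH rigid {g} cg (neg {h} Hh) =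
    rigid (g + h) (- h) (rigid⇒preservesH rigid cg Hh g cg)
      (subst (λ z → c z ≡ j) (sym (add-sub-cancel g h)) cg)
  rigid⇒preservesH rigid cg (add {h₁} {h₂} Hh₁ Hh₂) a ca =
    subst (λ z → c z ≡ j) (assoc a h₁ h₂)
      (rigid⇒preservesH rigid cg Hh₂ (a + h₁) (rigid⇒preservesH rigid cg Hh₁ a ca))

  rigid⇒coset : ∃[ g ] c g ≡ j → Rigid → IsCosetOfH G c j
  rigid⇒coset (g , cg) rigid = g , λ x →
    (λ cx → x - g , difference∈H cx cg , sym (add-sub x g)) ,
    (λ { (h , Hh , refl) → rigid⇒preservesH rigid cg Hh g cg })

  coset⇒preservesH : IsCosetOfH G c j → ∀ {h} → H G c j h → Preserves h
  coset⇒preservesH (g , coset) {h} Hh y cy with proj₁ (coset y) cy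
  ... | h′ , Hh′ , y≡g+h′ =
    proj₂ (coset (y + h)) (h′ + h , add Hh′ Hh , trans (cong (_+ h) y≡g+h′) (assoc g h′ h))

  coset⇒rigid : IsCosetOfH G c j → Rigid
  coset⇒rigid coset a h ca ca+h =
    coset⇒preservesH coset (subst (H G c j) (add-sub-left a h) (difference∈H ca+h ca))

propositionG : (n : ℕ) (G : FinAbGroup n) (m : ℕ) (c : Fin n → Fin m) →
    AllNonempty G c →
    (Bimodal G c → (i : Fin m) → 1 < blockSize G c i → IsCosetOfH G c i) ×
    (((i : Fin m) → 1 < blockSize G c i → IsCosetOfH G c i) → Bimodal G c)
propositionG n G m c nonempty = bimodal⇒cosets , cosets⇒bimodal
  where
  open Block G c

  bimodal⇒cosets : Bimodal G c → ∀ i → 1 < blockSize G c i → IsCosetOfH G c i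
  bimodal⇒cosets bimodal i _ =
    rigid⇒coset i (nonempty i) (bimodal⇒rigid i λ δ δ≢0 → bimodal δ δ≢0 i)

  cosets⇒bimodal : (∀ i → 1 < blockSize G c i → IsCosetOfH G c i) → Bimodal G c
  cosets⇒bimodal cosets δ _ j with 1 <? blockSize G c j
  ... | yes k>1 = rigid⇒bimodalAt j (coset⇒rigid j (cosets j k>1)) δ
  ... | no k≯1 = small⇒bimodalAt j (≮⇒≥ k≯1) δ
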